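{- Let $[9,00,01]$ be the two-vertex Boolean network $f_1=x_1$, $f_2=x_1\oplus x_2$. For every delay vector $(\alpha,\beta)$, there exist initial configurations from which the MBN built on $[9,00,01]$ with delays $(\alpha,\beta)$ evolves towards a limit cycle; in particular this MBN admits a limit cycle.
   Context: The MBN built on a two-vertex Boolean network $(f_1,f_2)$ with delay vector $(\alpha,\beta)$ of positive integers has configurations $(\rho,\gamma)$ with $0\le\rho\le\alpha$, $0\le\gamma\le\beta$, underlying Boolean state $x=([\rho\ge1],[\gamma\ge1])$, and dynamics: the first coordinate becomes $\alpha$ if $f_1(x)=1$, else $\max(\rho-1,0)$; the second becomes $\beta$ if $f_2(x)=1$, else $\max(\gamma-1,0)$. A limit cycle is a periodic orbit of length $\ge2$. $\oplus$ is exclusive or. -}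

module Defs where

open import Data.Bool using (Bool; true; false; if_then_else_; _xor_)
open import Data.Nat using (ℕ; zero; suc; _∸_; _≤_; _<_)
open import Data.Product using (_×_; _,_; Σ; ∃; ∃-syntax)
open import Relation.Binary.PropositionalEquality using (_≡_; _≢_)

BN2 : Set
BN2 = (Bool → Bool → Bool) × (Bool → Bool → Bool)

net9-00-01 : BN2
net9-00-01 = (λ x₁ x₂ → x₁) , (λ x₁ x₂ → x₁ xor x₂)

pos : ℕ → Bool
pos zero    = false
pos (suc _) = true

Config : Set
Config = ℕ × ℕ

Valid : (α β : ℕ) → Config → Set
Valid α β (ρ , γ) = (ρ ≤ α) × (γ ≤ β)

-- One step of the MBN built on network F with delays (α , β).
-- max(ρ - 1, 0) = ρ ∸ 1 on ℕ.
step : BN2 → (α β : ℕ) → Config → Config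
step (f₁ , f₂) α β (ρ , γ) =
  (if f₁ (pos ρ) (pos γ) then α else ρ ∸ 1) ,
  (if f₂ (pos ρ) (pos γ) then β else γ ∸ 1)

iterate : (Config → Config) → ℕ → Config → Config
iterate g zero    c = c
iterate g (suc n) c = g (iterate g n c)

OnLimitCycle : (Config → Config) → Config → Set
OnLimitCycle g c =
  ∃[ p ] (2 ≤ p × iterate g p c ≡ c × (∀ k → 1 ≤ k → k < p → iterate g k c ≢ c))

EvolvesToLimitCycle : (Config → Config) → Config → Set
EvolvesToLimitCycle g c = ∃[ t ] OnLimitCycle g (iterate g t c)

{-# OPTIONS --safe #-}
-- Once x₁ = 1 the first delay stays saturated at α (f₁ = x₁), and f₂ = ¬ x₂, so the
-- second coordinate counts down β, β - 1, …, 1, 0 and is then reset to β: from (α , 0)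
-- the dynamics is a cycle of length β + 1 ≥ 2.
module Submission where

open import Defs
open import Data.Nat using (ℕ; zero; suc; pred; _∸_; _≤_; _<_; z≤n; s≤s)
open import Data.Nat.Properties
  using (≤-refl; <⇒≤; n∸n≡0; pred[m∸n]≡m∸[1+n]; m<n⇒0<n∸m; m>n⇒m∸n≢0)
open import Data.Product using (_×_; ∃-syntax; _,_; proj₂)
open import Relation.Binary.PropositionalEquality
  using (_≡_; _≢_; refl; sym; cong; trans; module ≡-Reasoning)

step-active-zero : ∀ α β ρ → step net9-00-01 α β (suc ρ , 0) ≡ (α , β)
step-active-zero α β ρ = refl

step-active-pos : ∀ α β ρ {γ} → 1 ≤ γ → step net9-00-01 α β (suc ρ , γ) ≡ (α , pred γ)
step-active-pos α β ρ (s≤s z≤n) = refl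

countdown : ∀ a β k → k ≤ β →
  iterate (step net9-00-01 (suc a) β) (suc k) (suc a , 0) ≡ (suc a , β ∸ k)
countdown a β zero    _   = step-active-zero (suc a) β a
countdown a β (suc k) k<β = begin
  g (iterate g (suc k) (suc a , 0)) ≡⟨ cong g (countdown a β k (<⇒≤ k<β)) ⟩
  g (suc a , β ∸ k)                 ≡⟨ step-active-pos (suc a) β a (m<n⇒0<n∸m k<β) ⟩
  (suc a , pred (β ∸ k))            ≡⟨ cong (suc a ,_) (pred[m∸n]≡m∸[1+n] β k) ⟩
  (suc a , β ∸ suc k)               ∎
  where
  open ≡-Reasoning
  g = step net9-00-01 (suc a) β

active-zero-on-limit-cycle : ∀ a β → 1 ≤ β →
  OnLimitCycle (step net9-00-01 (suc a) β) (suc a , 0)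
active-zero-on-limit-cycle a β 1≤β =
  suc β , s≤s 1≤β , returns , no-earlier-return
  where
  g = step net9-00-01 (suc a) β

  returns : iterate g (suc β) (suc a , 0) ≡ (suc a , 0)
  returns = trans (countdown a β β ≤-refl) (cong (suc a ,_) (n∸n≡0 β))

  no-earlier-return : ∀ k → 1 ≤ k → k < suc β → iterate g k (suc a , 0) ≢ (suc a , 0)
  no-earlier-return (suc k) _ (s≤s k<β) back =
    m>n⇒m∸n≢0 k<β (cong proj₂ (trans (sym (countdown a β k (<⇒≤ k<β))) back))

proposition11 : (α β : ℕ) → 1 ≤ α → 1 ≤ β →
    (∃[ c ] (Valid α β c × EvolvesToLimitCycle (step net9-00-01 α β) c))
    × (∃[ c ] (Valid α β c × OnLimitCycle (step net9-00-01 α β) c))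
proposition11 (suc a) β _ 1≤β =
  (c , valid , 0 , cycle) , (c , valid , cycle)
  where
  c = (suc a , 0)
  valid : Valid (suc a) β c
  valid = ≤-refl , z≤n
  cycle : OnLimitCycle (step net9-00-01 (suc a) β) c
  cycle = active-zero-on-limit-cycle a β 1≤β
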